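{- Let $(E,\mathcal{D},\rho)$ and $(E,\mathcal{D},\phi)$ be U-matroids such that $\phi(S)\ge\rho(S)$ for all $S\in\mathcal{D}$, and let $a\in E$ with $\{a\}\notin\mathcal{D}$. Then the generous atom extension $\phi_a$ of $\phi$ to $\mathcal{D}[a]$ satisfies $\phi_a(S)\ge\rho'(S)$ for all $S\in\mathcal{D}[a]$, for every lattice extension $(E,\mathcal{D}[a],\rho')$ of $(E,\mathcal{D},\rho)$.
   Context: $E$ is a finite set. A U-matroid is a triple $(E,\mathcal{D},\rho)$ where $\mathcal{D}\subseteq2^E$ contains $\emptyset,E$, is closed under union and intersection, and is accessible (every nonempty $A\in\mathcal{D}$ contains some $x$ with $A\setminus\{x\}\in\mathcal{D}$), and $\rho:\mathcal{D}\to\mathbb{N}$ satisfies $\rho(\emptyset)=0$, monotonicity, submodularity, and unit increase ($\rho(A\cup\{e\})-\rho(A)\le1$ whenever $A,A\cup\{e\}\in\mathcal{D}$). A lattice extension of $(E,\mathcal{D},\rho)$ to $\mathcal{D}'\supseteq\mathcal{D}$ is a U-matroid $(E,\mathcal{D}',\rho')$ with $\rho'|_{\mathcal{D}}=\rho$. Let $\mathcal{D}[a]=\mathcal{D}\cup\{S\cup\{a\}:S\in\mathcal{D}\}$ and $\sup_{\mathcal{D}}(A)$ the smallest element of $\mathcal{D}$ containing $A$. The generous atom extension of $\phi$ is $\phi_a:\mathcal{D}[a]\to\mathbb{N}$ with $\phi_a(S)=\phi(S)$ if $S\in\mathcal{D}$; $\phi_a(S)=\phi(S\setminus\{a\})$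 if $S\notin\mathcal{D}$ and $\phi(S\setminus\{a\})=\phi(\sup_{\mathcal{D}}(S))$; and $\phi_a(S)=\phi(S\setminus\{a\})+1$ if $S\notin\mathcal{D}$ and $\phi(S\setminus\{a\})<\phi(\sup_{\mathcal{D}}(S))$. -}

module Defs where

open import Data.Nat using (ℕ; zero; suc; _+_; _≤_)
open import Data.Bool using (Bool; true; false; T; if_then_else_; _∧_)
open import Data.Fin using (Fin)
open import Data.Fin.Subset using (Subset; _∪_; _∩_; _⊆_; _-_; ⁅_⁆; ⊥; ⊤; _∈_; _∉_; Nonempty)
open import Data.Fin.Subset.Properties using (_⊆?_)
open import Data.Vec.Properties using (≡-dec)
open import Data.Vec using (Vec; []; _∷_)
open import Data.List using (List; []; _∷_; map; _++_; foldr)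
open import Data.Product using (Σ; _×_; ∃)
open import Relation.Binary.PropositionalEquality using (_≡_)
open import Relation.Nullary.Decidable using (⌊_⌋; yes; no)

-- The ground set E is Fin n; subsets of E are `Subset n`.
-- A family 𝒟 ⊆ 2^E is given by its (decidable) characteristic function.
Family : ℕ → Set
Family n = Subset n → Bool

_∈𝒟_ : ∀ {n} → Subset n → Family n → Set
S ∈𝒟 𝒟 = T (𝒟 S)

_∉𝒟_ : ∀ {n} → Subset n → Family n → Set
S ∉𝒟 𝒟 = T (𝒟 S) → Data.Empty.⊥
  where import Data.Empty

record IsAccessibleLattice {n : ℕ} (𝒟 : Family n) : Set where
  field
    empty∈ : ⊥ ∈𝒟 𝒟
    full∈  : ⊤ ∈𝒟 𝒟
    ∪-closed : ∀ A B → A ∈𝒟 𝒟 → B ∈𝒟 𝒟 → (A ∪ B) ∈𝒟 𝒟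
    ∩-closed : ∀ A B → A ∈𝒟 𝒟 → B ∈𝒟 𝒟 → (A ∩ B) ∈𝒟 𝒟
    accessible : ∀ A → A ∈𝒟 𝒟 → Nonempty A →
                 ∃ λ (x : Fin n) → x ∈ A × (A - x) ∈𝒟 𝒟

-- A U-matroid (E, 𝒟, ρ).  ρ is given as a function on all subsets,
-- but only its values on members of 𝒟 are constrained/used.
record IsUMatroid {n : ℕ} (𝒟 : Family n) (ρ : Subset n → ℕ) : Set where
  field
    lattice : IsAccessibleLattice 𝒟
    rank-empty : ρ ⊥ ≡ 0
    monotone : ∀ A B → A ∈𝒟 𝒟 → B ∈𝒟 𝒟 → A ⊆ B → ρ A ≤ ρ B
    submodular : ∀ A B → A ∈𝒟 𝒟 → B ∈𝒟 𝒟 →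
                 ρ (A ∪ B) + ρ (A ∩ B) ≤ ρ A + ρ B
    unit-increase : ∀ A (e : Fin n) → A ∈𝒟 𝒟 → (A ∪ ⁅ e ⁆) ∈𝒟 𝒟 →
                    ρ (A ∪ ⁅ e ⁆) ≤ suc (ρ A)

record IsLatticeExtension {n : ℕ} (𝒟 : Family n) (ρ : Subset n → ℕ)
                          (𝒟' : Family n) (ρ' : Subset n → ℕ) : Set where
  field
    family-⊇ : ∀ S → S ∈𝒟 𝒟 → S ∈𝒟 𝒟'
    umatroid : IsUMatroid 𝒟' ρ'
    restricts : ∀ S → S ∈𝒟 𝒟 → ρ' S ≡ ρ S

allSubsets : (n : ℕ) → List (Subset n)
allSubsets zero = [] ∷ []
allSubsets (suc n) =
  map (false ∷_) (allSubsets n) ++ map (true ∷_) (allSubsets n)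

-- 𝒟[a] = 𝒟 ∪ { S ∪ {a} : S ∈ 𝒟 }.  Membership is decidable:
-- T ∈ 𝒟[a] iff T ∈ 𝒟 or T = S ∪ {a} for some S ∈ 𝒟 among all subsets.
anyL : ∀ {A : Set} → (A → Bool) → List A → Bool
anyL p [] = false
anyL p (x ∷ xs) = if p x then true else anyL p xs

adjoin : ∀ {n} → Family n → Fin n → Family n
adjoin {n} 𝒟 a T =
  if 𝒟 T then true
  else anyL (λ S → 𝒟 S ∧ ⌊ ≡-dec Data.Bool._≟_ (S ∪ ⁅ a ⁆) T ⌋) (allSubsets n)
  where import Data.Bool

-- sup_𝒟(A): the intersection of all members of 𝒟 containing A
-- (this is the smallest member of 𝒟 containing A when 𝒟 contains E and
-- is closed under intersection).
sup : ∀ {n} → Family n → Subset n → Subset n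
sup {n} 𝒟 A =
  foldr (λ S acc → if 𝒟 S ∧ ⌊ A ⊆? S ⌋ then S ∩ acc else acc) ⊤ (allSubsets n)

-- Generous atom extension φ_a of φ to 𝒟[a] (values outside 𝒟[a]
-- are irrelevant; for S ∉ 𝒟 we use the paper's formula).
generous : ∀ {n} → Family n → (Subset n → ℕ) → Fin n → Subset n → ℕ
generous 𝒟 φ a S with 𝒟 S
... | true = φ S
... | false with φ (S - a) Data.Nat.≟ φ (sup 𝒟 S)
...   | yes _ = φ (S - a)
...   | no _  = suc (φ (S - a))
  where import Data.Nat

{-# OPTIONS --safe #-}
-- If S ∈ 𝒟 then ρ'(S) = ρ(S) ≤ φ(S) = φₐ(S).  Otherwise S = X ∪ {a} with
-- X ∈ 𝒟 and a ∉ X, so X = S ∖ a, and ρ'(S) has two upper bounds: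
-- ρ'(S) ≤ ρ'(X) + 1 = ρ(X) + 1 ≤ φ(S ∖ a) + 1 by unit increase, and
-- ρ'(S) ≤ ρ'(sup S) = ρ(sup S) ≤ φ(sup S) by monotonicity.  The generous
-- extension takes the first value unless φ(S ∖ a) = φ(sup S), in which case
-- it equals the second.
module Submission where

open import Defs
open import Data.Bool using (Bool; true; false; T; if_then_else_; _∧_)
open import Data.Bool.Properties using (T-∧; T-≡)
open import Data.Empty using (⊥-elim)
open import Data.Fin using (Fin; zero; suc)
open import Data.Fin.Subset as FS
  using (Subset; ⁅_⁆; _∪_; _∩_; _⊆_; _-_; _∈_; _∉_; inside; outside)
open import Data.Fin.Subset.Properties
  using (_⊆?_; _∈?_; ∈⊤; x∈p∩q⁺; ∪-identityʳ; p─⊥≡p)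
open import Data.List using (List; []; _∷_; foldr)
open import Data.Nat using (ℕ; suc; _≤_; _≟_; s≤s)
open import Data.Nat.Properties using (≤-trans; ≤-reflexive)
open import Data.Product using (∃; _×_; _,_; proj₁; proj₂)
open import Data.Unit using (tt)
open import Data.Vec using (_∷_; here; there)
open import Function.Bundles using (Equivalence)
open import Relation.Binary.PropositionalEquality
  using (_≡_; refl; sym; trans; cong; subst)
open import Relation.Nullary.Decidable using (⌊_⌋; yes; no; toWitness; T?)
open import Relation.Nullary.Negation using (¬_)

private
  variable
    n : ℕ

¬T⇒≡false : ∀ {b} → ¬ T b → b ≡ false
¬T⇒≡false {false} _  = refl
¬T⇒≡false {true}  ¬T = ⊥-elim (¬T tt)

x∈p⇒p∪⁅x⁆≡p : (p : Subset n) (x : Fin n) → x ∈ p → p ∪ ⁅ x ⁆ ≡ p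
x∈p⇒p∪⁅x⁆≡p (inside  ∷ p) zero    here        = cong (inside ∷_) (∪-identityʳ p)
x∈p⇒p∪⁅x⁆≡p (outside ∷ p) (suc x) (there x∈p) = cong (outside ∷_) (x∈p⇒p∪⁅x⁆≡p p x x∈p)
x∈p⇒p∪⁅x⁆≡p (inside  ∷ p) (suc x) (there x∈p) = cong (inside ∷_) (x∈p⇒p∪⁅x⁆≡p p x x∈p)

x∉p⇒p∪⁅x⁆-x≡p : (p : Subset n) (x : Fin n) → x ∉ p → (p ∪ ⁅ x ⁆) - x ≡ p
x∉p⇒p∪⁅x⁆-x≡p (outside ∷ p) zero    _   = cong (outside ∷_) (trans (p─⊥≡p _) (∪-identityʳ p))
x∉p⇒p∪⁅x⁆-x≡p (inside  ∷ p) zero    x∉p = ⊥-elim (x∉p here)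
x∉p⇒p∪⁅x⁆-x≡p (outside ∷ p) (suc x) x∉p = cong (outside ∷_) (x∉p⇒p∪⁅x⁆-x≡p p x (λ x∈p → x∉p (there x∈p)))
x∉p⇒p∪⁅x⁆-x≡p (inside  ∷ p) (suc x) x∉p = cong (inside ∷_) (x∉p⇒p∪⁅x⁆-x≡p p x (λ x∈p → x∉p (there x∈p)))

anyL-witness : ∀ {A : Set} (P : A → Bool) (xs : List A) → T (anyL P xs) → ∃ λ x → T (P x)
anyL-witness P (x ∷ xs) h with P x in Px
... | true  = x , Equivalence.from T-≡ Px
... | false = anyL-witness P xs h

module _ (𝒟 : Family n) (full∈ : FS.⊤ ∈𝒟 𝒟)
         (∩-closed : ∀ A B → A ∈𝒟 𝒟 → B ∈𝒟 𝒟 → (A ∩ B) ∈𝒟 𝒟) (A : Subset n) where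

  private
    meetIfAbove : Subset n → Subset n → Subset n
    meetIfAbove S acc = if 𝒟 S ∧ ⌊ A ⊆? S ⌋ then S ∩ acc else acc

    meetsAbove-closure : ∀ Ss → foldr meetIfAbove FS.⊤ Ss ∈𝒟 𝒟 × A ⊆ foldr meetIfAbove FS.⊤ Ss
    meetsAbove-closure [] = full∈ , λ _ → ∈⊤
    meetsAbove-closure (S ∷ Ss) with 𝒟 S in S∈𝒟 | A ⊆? S | meetsAbove-closure Ss
    ... | false | _         | IH = IH
    ... | true  | no _      | IH = IH
    ... | true  | yes A⊆S   | M∈𝒟 , A⊆M =
      ∩-closed S _ (Equivalence.from T-≡ S∈𝒟) M∈𝒟 , λ x∈A → x∈p∩q⁺ (A⊆S x∈A , A⊆M x∈A)

  sup∈𝒟 : sup 𝒟 A ∈𝒟 𝒟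
  sup∈𝒟 = proj₁ (meetsAbove-closure (allSubsets n))

  ⊆sup : A ⊆ sup 𝒟 A
  ⊆sup = proj₂ (meetsAbove-closure (allSubsets n))

adjoin-new : (𝒟 : Family n) (a : Fin n) (S : Subset n) → S ∉𝒟 𝒟 → S ∈𝒟 adjoin 𝒟 a →
             ∃ λ X → X ∈𝒟 𝒟 × X ∪ ⁅ a ⁆ ≡ S
adjoin-new {n} 𝒟 a S S∉𝒟 S∈𝒟[a] rewrite ¬T⇒≡false S∉𝒟
  with anyL-witness _ (allSubsets n) S∈𝒟[a]
... | X , X∈𝒟∧X∪a≡S with Equivalence.to T-∧ X∈𝒟∧X∪a≡S
... | X∈𝒟 , X∪a≡S = X , X∈𝒟 , toWitness X∪a≡S

adjoin-new-minus-atom : (𝒟 : Family n) (a : Fin n) (X : Subset n) →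
                   X ∈𝒟 𝒟 → (X ∪ ⁅ a ⁆) ∉𝒟 𝒟 → (X ∪ ⁅ a ⁆) - a ≡ X
adjoin-new-minus-atom 𝒟 a X X∈𝒟 X∪a∉𝒟 with a ∈? X
... | yes a∈X = ⊥-elim (X∪a∉𝒟 (subst (_∈𝒟 𝒟) (sym (x∈p⇒p∪⁅x⁆≡p X a a∈X)) X∈𝒟))
... | no  a∉X = x∉p⇒p∪⁅x⁆-x≡p X a a∉X

generous-∈ : (𝒟 : Family n) (φ : Subset n → ℕ) (a : Fin n) (S : Subset n) →
             S ∈𝒟 𝒟 → generous 𝒟 φ a S ≡ φ S
generous-∈ 𝒟 φ a S S∈𝒟 with 𝒟 S
... | true = refl

≤generous-∉ : (𝒟 : Family n) (φ : Subset n → ℕ) (a : Fin n) (S : Subset n) {m : ℕ} →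
              S ∉𝒟 𝒟 → m ≤ φ (sup 𝒟 S) → m ≤ suc (φ (S - a)) → m ≤ generous 𝒟 φ a S
≤generous-∉ 𝒟 φ a S S∉𝒟 m≤φsup m≤1+φS-a rewrite ¬T⇒≡false S∉𝒟
  with φ (S - a) ≟ φ (sup 𝒟 S)
... | yes φS-a≡φsup = ≤-trans m≤φsup (≤-reflexive (sym φS-a≡φsup))
... | no  _         = m≤1+φS-a

module _ {𝒟 : Family n} {ρ φ : Subset n → ℕ} (ρ≤φ : ∀ S → S ∈𝒟 𝒟 → ρ S ≤ φ S)
         {𝒟' : Family n} {ρ' : Subset n → ℕ} (ext : IsLatticeExtension 𝒟 ρ 𝒟' ρ') where

  open IsLatticeExtension ext
  open IsUMatroid umatroid

  extension≤ : ∀ S → S ∈𝒟 𝒟 → ρ' S ≤ φ S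
  extension≤ S S∈𝒟 = ≤-trans (≤-reflexive (restricts S S∈𝒟)) (ρ≤φ S S∈𝒟)

  extension≤sup : IsAccessibleLattice 𝒟 → ∀ S → S ∈𝒟 𝒟' → ρ' S ≤ φ (sup 𝒟 S)
  extension≤sup L S S∈𝒟' = ≤-trans
    (monotone S (sup 𝒟 S) S∈𝒟' (family-⊇ _ sup∈) (⊆sup 𝒟 full∈ ∩-closed S))
    (extension≤ (sup 𝒟 S) sup∈)
    where
    open IsAccessibleLattice L using (full∈; ∩-closed)
    sup∈ : sup 𝒟 S ∈𝒟 𝒟
    sup∈ = sup∈𝒟 𝒟 full∈ ∩-closed S

  extension≤1+ : ∀ X e → X ∈𝒟 𝒟 → (X ∪ ⁅ e ⁆) ∈𝒟 𝒟' → ρ' (X ∪ ⁅ e ⁆) ≤ suc (φ X)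
  extension≤1+ X e X∈𝒟 X∪e∈𝒟' =
    ≤-trans (unit-increase X e (family-⊇ X X∈𝒟) X∪e∈𝒟') (s≤s (extension≤ X X∈𝒟))

proposition4p11 : (n : ℕ) (𝒟 : Family n) (ρ φ : Subset n → ℕ) →
    IsUMatroid 𝒟 ρ → IsUMatroid 𝒟 φ →
    (∀ S → S ∈𝒟 𝒟 → ρ S ≤ φ S) →
    (a : Fin n) → ⁅ a ⁆ ∉𝒟 𝒟 →
    (ρ' : Subset n → ℕ) → IsLatticeExtension 𝒟 ρ (adjoin 𝒟 a) ρ' →
    ∀ S → S ∈𝒟 adjoin 𝒟 a → ρ' S ≤ generous 𝒟 φ a S
proposition4p11 n 𝒟 ρ φ Uρ _ ρ≤φ a _ ρ' ext S S∈𝒟[a] with T? (𝒟 S)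
... | yes S∈𝒟 = subst (ρ' S ≤_) (sym (generous-∈ 𝒟 φ a S S∈𝒟)) (extension≤ ρ≤φ ext S S∈𝒟)
... | no  S∉𝒟 with adjoin-new 𝒟 a S S∉𝒟 S∈𝒟[a]
...   | X , X∈𝒟 , refl = ≤generous-∉ 𝒟 φ a S S∉𝒟
          (extension≤sup ρ≤φ ext (IsUMatroid.lattice Uρ) S S∈𝒟[a])
          (subst (λ Y → ρ' S ≤ suc (φ Y)) (sym (adjoin-new-minus-atom 𝒟 a X X∈𝒟 S∉𝒟))
                 (extension≤1+ ρ≤φ ext X a X∈𝒟 S∈𝒟[a]))
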